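{- Let $G=(V,E)$ be a connected graph with at least two vertices and let $X\subseteq V$ be the set of cut vertices of $G$. If $\mathrm{evc}(G)=\mathrm{mvc}(G)$, then for every vertex $v\in V\setminus X$ there is a minimum vertex cover $S_v$ of $G$ such that $X\cup\{v\}\subseteq S_v$.
   Context: All graphs are finite and simple. $\mathrm{mvc}(G)$ denotes the minimum cardinality of a vertex cover of $G$. Eternal vertex cover game: guards are placed on vertices of $G$, at most one guard per vertex; the set of occupied vertices is a configuration. In each round an attacker chooses an edge $uv$; the defender responds by moving guards simultaneously, each guard either staying put or moving to an adjacent vertex, such that at least one guard moves across the attacked edge, and after the move at most one guard is on each vertex; the number of guards never changes. An eternal vertex cover class of $G$ is a family $\mathcal{C}$ of vertex covers of $G$, all of the same cardinality, such that for every configuration $S\in\mathcal{C}$ and every attacked edge, the attack can be defended by a legal move leading to a configuration in $\mathcal{C}$. The eternal vertex cover number $\mathrm{evc}(G)$ is the minimum cardinality of a configuration of an eternal vertex cover class of $G$. -}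

module Defs where

open import Level using (0ℓ)
open import Data.Nat using (ℕ; _≤_)
open import Data.Fin using (Fin)
open import Data.Fin.Subset using (Subset; _∈_; ∣_∣)
open import Data.Product using (Σ; ∃; ∃-syntax; _×_)
open import Data.Sum using (_⊎_)
open import Relation.Nullary using (¬_)
open import Relation.Binary.PropositionalEquality using (_≡_; _≢_)
open import Relation.Binary.Construct.Closure.ReflexiveTransitive using (Star)

record Graph : Set₁ where
  field
    n     : ℕ
    Adj   : Fin n → Fin n → Set
    sym   : ∀ {u v} → Adj u v → Adj v u
    irrefl : ∀ {u} → ¬ Adj u u

module _ (G : Graph) where
  open Graph G

  Connected : Set
  Connected = ∀ u v → Star Adj u v

  AdjWithout : Fin n → Fin n → Fin n → Set
  AdjWithout v x y = Adj x y × x ≢ v × y ≢ v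

  -- v is a cut vertex: there are two vertices distinct from v, connected in G,
  -- but not connected in G - v (i.e. removing v increases the number of components).
  IsCutVertex : Fin n → Set
  IsCutVertex v = ∃[ a ] ∃[ b ] (a ≢ v × b ≢ v × Star Adj a b × ¬ Star (AdjWithout v) a b)

  IsVertexCover : Subset n → Set
  IsVertexCover S = ∀ u v → Adj u v → u ∈ S ⊎ v ∈ S

  IsMinVertexCover : Subset n → Set
  IsMinVertexCover S = IsVertexCover S × (∀ T → IsVertexCover T → ∣ S ∣ ≤ ∣ T ∣)

  IsMVC : ℕ → Set
  IsMVC k = Σ (Subset n) λ S → IsMinVertexCover S × ∣ S ∣ ≡ k

  -- A legal move of guards from configuration S to configuration S' defending
  -- the attack on edge uv. The guard on x (x ∈ S) moves to f x.
  Defends : Subset n → Subset n → Fin n → Fin n → Set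
  Defends S S' u v = Σ (Fin n → Fin n) λ f →
      (∀ x → x ∈ S → f x ≡ x ⊎ Adj x (f x))
    × (∀ x y → x ∈ S → y ∈ S → f x ≡ f y → x ≡ y)
    × (∀ y → y ∈ S' → ∃[ x ] (x ∈ S × f x ≡ y))
    × (∀ x → x ∈ S → f x ∈ S')
    × ((u ∈ S × f u ≡ v) ⊎ (v ∈ S × f v ≡ u))

  IsEVCClass : (Subset n → Set) → ℕ → Set
  IsEVCClass C k =
      (∀ S → C S → IsVertexCover S × ∣ S ∣ ≡ k)
    × (∀ S → C S → ∀ u v → Adj u v → ∃[ S' ] (C S' × Defends S S' u v))

  IsEVC : ℕ → Set₁
  IsEVC k =
      (Σ (Subset n → Set) λ C → IsEVCClass C k × ∃[ S ] C S)
    × (∀ (C : Subset n → Set) j → IsEVCClass C j → ∀ S → C S → k ≤ ∣ S ∣)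

{-# OPTIONS --safe #-}
module Submission where

-- Suppose a cut vertex x is unguarded in a configuration S of an eternal class of size
-- mvc(G). Pick neighbours y₁, y₂ of x in different components of G - x and defend the attacks
-- on x y₁ and on x y₂ separately. Moving guards by the first defence inside the component of
-- y₁ and by the second elsewhere, the guards of y₁ and y₂ both land on x and the result still
-- covers every edge: a vertex cover smaller than mvc(G). So every configuration, each being a
-- minimum vertex cover, holds all cut vertices, and attacking an edge at v yields one holding v.

open import Data.Nat using (_≤_; _<_; suc; s≤s)
open import Data.Nat.Properties using (≤-trans; ≤-reflexive; m≤n⇒m≤1+n; n≮n; module ≤-Reasoning)
open import Data.Fin using (Fin; zero; suc)
open import Data.Fin.Properties using (_≟_)
open import Data.Fin.Subset using (Subset; _∈_; _∉_; ∣_∣; ⁅_⁆; _∪_; _-_; ⊥; inside; outside)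
open import Data.Fin.Subset.Properties
  using (_∈?_; ∣⊥∣≡0; x∈⁅x⁆; x∈p∪q⁺; ∪-identityˡ; x∈p∧x≢y⇒x∈p-y; x∈p⇒∣p-x∣<∣p∣)
open import Data.Vec.Base using (_∷_; []; here; there)
open import Data.Product using (∃-syntax; _×_; _,_; proj₁; proj₂)
open import Data.Sum as Sum using (_⊎_; inj₁; inj₂)
import Data.Empty as Empty
open import Function using (_∘_; id)
open import Relation.Nullary using (¬_; yes; no)
open import Relation.Nullary.Decidable using (¬¬-excluded-middle)
open import Relation.Unary using (Decidable)
open import Relation.Binary.PropositionalEquality using (_≡_; _≢_; refl; sym; trans; cong; subst)
open import Relation.Binary.Construct.Closure.ReflexiveTransitive using (Star; ε; _◅_; _◅◅_; reverse)
open import Defs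

image : ∀ {m n} → (Fin m → Fin n) → Subset m → Subset n
image h []            = ⊥
image h (inside ∷ p)  = ⁅ h zero ⁆ ∪ image (h ∘ suc) p
image h (outside ∷ p) = image (h ∘ suc) p

∈-image⁺ : ∀ {m n} (h : Fin m → Fin n) {p w} → w ∈ p → h w ∈ image h p
∈-image⁺ h {inside ∷ p}  here        = x∈p∪q⁺ (inj₁ (x∈⁅x⁆ (h zero)))
∈-image⁺ h {inside ∷ p}  (there w∈p) = x∈p∪q⁺ (inj₂ (∈-image⁺ (h ∘ suc) w∈p))
∈-image⁺ h {outside ∷ p} (there w∈p) = ∈-image⁺ (h ∘ suc) w∈p

∣⁅x⁆∪p∣≤1+∣p∣ : ∀ {n} (x : Fin n) p → ∣ ⁅ x ⁆ ∪ p ∣ ≤ suc ∣ p ∣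
∣⁅x⁆∪p∣≤1+∣p∣ zero    (outside ∷ p) = s≤s (≤-reflexive (cong ∣_∣ (∪-identityˡ p)))
∣⁅x⁆∪p∣≤1+∣p∣ zero    (inside ∷ p)  = s≤s (m≤n⇒m≤1+n (≤-reflexive (cong ∣_∣ (∪-identityˡ p))))
∣⁅x⁆∪p∣≤1+∣p∣ (suc x) (outside ∷ p) = ∣⁅x⁆∪p∣≤1+∣p∣ x p
∣⁅x⁆∪p∣≤1+∣p∣ (suc x) (inside ∷ p)  = s≤s (∣⁅x⁆∪p∣≤1+∣p∣ x p)

∣image∣≤∣p∣ : ∀ {m n} (h : Fin m → Fin n) p → ∣ image h p ∣ ≤ ∣ p ∣
∣image∣≤∣p∣ {n = n} h []    = ≤-reflexive (∣⊥∣≡0 n)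
∣image∣≤∣p∣ h (inside ∷ p)  = ≤-trans (∣⁅x⁆∪p∣≤1+∣p∣ (h zero) _) (s≤s (∣image∣≤∣p∣ (h ∘ suc) p))
∣image∣≤∣p∣ h (outside ∷ p) = ∣image∣≤∣p∣ (h ∘ suc) p

¬¬-decidable : ∀ {n} (P : Fin n → Set) → ¬ ¬ Decidable P
¬¬-decidable {0}     P k = k (λ ())
¬¬-decidable {suc n} P k = ¬¬-excluded-middle λ P₀? → ¬¬-decidable (P ∘ suc) λ P₊? →
  k λ { zero → P₀? ; (suc z) → P₊? z }

another-vertex : ∀ {n} → 2 ≤ n → (v : Fin n) → ∃[ w ] (w ≢ v)
another-vertex (s≤s (s≤s _)) zero    = suc zero , λ ()
another-vertex (s≤s (s≤s _)) (suc v) = zero , λ ()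

module _ (G : Graph) where
  open Graph G renaming (sym to adj-sym)

  neighbour : Connected G → 2 ≤ n → ∀ v → ∃[ u ] Adj v u
  neighbour connected 2≤n v with another-vertex 2≤n v
  ... | w , w≢v = first-step w≢v (connected v w)
    where
      first-step : ∀ {w} → w ≢ v → Star Adj v w → ∃[ u ] Adj v u
      first-step w≢v ε       = Empty.⊥-elim (w≢v refl)
      first-step _   (e ◅ _) = _ , e

  Walk-avoiding : Fin n → Fin n → Fin n → Set
  Walk-avoiding x = Star (AdjWithout G x)

  avoiding-sym : ∀ {x u w} → AdjWithout G x u w → AdjWithout G x w u
  avoiding-sym (e , u≢x , w≢x) = adj-sym e , w≢x , u≢x

  walk-avoids-or-meets-neighbour : ∀ {x a b} → a ≢ x → Star Adj a b →
    Walk-avoiding x a b ⊎ ∃[ y ] (Walk-avoiding x a y × Adj y x)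
  walk-avoids-or-meets-neighbour a≢x ε = inj₁ ε
  walk-avoids-or-meets-neighbour {x} {a} a≢x (_◅_ {j = c} e walk) with c ≟ x
  ... | yes refl = inj₂ (a , ε , e)
  ... | no c≢x   = Sum.map (step ◅_) (λ (y , p , e′) → y , step ◅ p , e′)
                           (walk-avoids-or-meets-neighbour c≢x walk)
    where
      step : AdjWithout G x a c
      step = e , a≢x , c≢x

  walk-meets-neighbour : ∀ {x a b} → a ≢ x → Star Adj a b → ¬ Walk-avoiding x a b →
                         ∃[ y ] (Walk-avoiding x a y × Adj y x)
  walk-meets-neighbour a≢x walk ¬avoids =
    Sum.[ Empty.⊥-elim ∘ ¬avoids , id ]′ (walk-avoids-or-meets-neighbour a≢x walk)

  cut-vertex-separates-neighbours : ∀ {x} → IsCutVertex G x →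
    ∃[ y₁ ] ∃[ y₂ ] (Adj x y₁ × Adj x y₂ × ¬ Walk-avoiding x y₁ y₂)
  cut-vertex-separates-neighbours (a , b , a≢x , b≢x , ab , ¬ab)
    with walk-meets-neighbour a≢x ab ¬ab
       | walk-meets-neighbour b≢x (reverse adj-sym ab) (¬ab ∘ reverse avoiding-sym)
  ... | y₁ , a⋯y₁ , e₁ | y₂ , b⋯y₂ , e₂ =
    y₁ , y₂ , adj-sym e₁ , adj-sym e₂ ,
    λ y₁⋯y₂ → ¬ab (a⋯y₁ ◅◅ y₁⋯y₂ ◅◅ reverse avoiding-sym b⋯y₂)

  Stays-or-steps : Fin n → Fin n → Set
  Stays-or-steps w w′ = w′ ≡ w ⊎ Adj w w′

  stays-or-steps-sym : ∀ {w w′} → Stays-or-steps w w′ → Stays-or-steps w′ w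
  stays-or-steps-sym = Sum.map sym adj-sym

  stays-in-component : ∀ {x y w w′} → w ≢ x → w′ ≢ x → Stays-or-steps w w′ →
                       Walk-avoiding x y w → Walk-avoiding x y w′
  stays-in-component _   _    (inj₁ refl) y⋯w = y⋯w
  stays-in-component w≢x w′≢x (inj₂ e)    y⋯w = y⋯w ◅◅ ((e , w≢x , w′≢x) ◅ ε)

  module Defence {S S′ u v} (d : Defends G S S′ u v) where
    move : Fin n → Fin n
    move = proj₁ d

    move-stays-or-steps : ∀ {w} → w ∈ S → Stays-or-steps w (move w)
    move-stays-or-steps = proj₁ (proj₂ d) _

    move-onto : ∀ {z} → z ∈ S′ → ∃[ w ] (w ∈ S × move w ≡ z)
    move-onto = proj₁ (proj₂ (proj₂ (proj₂ d))) _

    move-into : ∀ {w} → w ∈ S → move w ∈ S′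
    move-into = proj₁ (proj₂ (proj₂ (proj₂ (proj₂ d)))) _

    unguarded-endpoint : u ∉ S → v ∈ S × move v ≡ u
    unguarded-endpoint u∉S with proj₂ (proj₂ (proj₂ (proj₂ (proj₂ d))))
    ... | inj₁ (u∈S , _) = Empty.⊥-elim (u∉S u∈S)
    ... | inj₂ crossing  = crossing

    unguarded-endpoint-occupied : u ∉ S → u ∈ S′
    unguarded-endpoint-occupied u∉S with unguarded-endpoint u∉S
    ... | v∈S , v↦u = subst (_∈ S′) v↦u (move-into v∈S)

  occupied-in-class : ∀ {C k S₀ u v} → IsEVCClass G C k → C S₀ → Adj v u → ∃[ S ] (C S × v ∈ S)
  occupied-in-class {S₀ = S₀} {u} {v} (_ , defend) S₀∈C e with v ∈? S₀
  ... | yes v∈S₀ = S₀ , S₀∈C , v∈S₀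
  ... | no  v∉S₀ with defend S₀ S₀∈C v u e
  ...   | S , S∈C , d = S , S∈C , Defence.unguarded-endpoint-occupied d v∉S₀

  module Combined-defence {x y₁ y₂ S S₁ S₂} (x∉S : x ∉ S)
    (cover₁ : IsVertexCover G S₁) (cover₂ : IsVertexCover G S₂)
    (d₁ : Defends G S S₁ x y₁) (d₂ : Defends G S S₂ x y₂)
    (separated : ¬ Walk-avoiding x y₁ y₂) (near? : Decidable (Walk-avoiding x y₁)) where

    module D₁ = Defence d₁
    module D₂ = Defence d₂

    Near : Fin n → Set
    Near = Walk-avoiding x y₁

    combined : Fin n → Fin n
    combined w with near? w
    ... | yes _ = D₁.move w
    ... | no  _ = D₂.move w

    combined-near : ∀ {w} → Near w → combined w ≡ D₁.move w
    combined-near {w} near-w with near? w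
    ... | yes _      = refl
    ... | no ¬near-w = Empty.⊥-elim (¬near-w near-w)

    combined-far : ∀ {w} → ¬ Near w → combined w ≡ D₂.move w
    combined-far {w} ¬near-w with near? w
    ... | yes near-w = Empty.⊥-elim (¬near-w near-w)
    ... | no _       = refl

    T : Subset n
    T = image combined (S - y₂)

    T-smaller : ∣ T ∣ < ∣ S ∣
    T-smaller = ≤-trans (s≤s (∣image∣≤∣p∣ combined (S - y₂)))
                        (x∈p⇒∣p-x∣<∣p∣ (proj₁ (D₂.unguarded-endpoint x∉S)))

    guarded-vertex≢x : ∀ {w} → w ∈ S → w ≢ x
    guarded-vertex≢x w∈S refl = x∉S w∈S

    combined-lands-in-T : ∀ {w z} → w ∈ S → w ≢ y₂ → combined w ≡ z → z ∈ T
    combined-lands-in-T w∈S w≢y₂ w↦z =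
      subst (_∈ T) w↦z (∈-image⁺ combined (x∈p∧x≢y⇒x∈p-y w∈S w≢y₂))

    x∈T : x ∈ T
    x∈T with D₁.unguarded-endpoint x∉S
    ... | y₁∈S , y₁↦x = combined-lands-in-T y₁∈S (λ { refl → separated ε })
                                             (trans (combined-near ε) y₁↦x)

    near-guarded : ∀ {z} → z ∈ S₁ → z ≢ x → Near z → z ∈ T
    near-guarded z∈S₁ z≢x near-z with D₁.move-onto z∈S₁
    ... | w , w∈S , w↦z = combined-lands-in-T w∈S (λ { refl → separated near-w })
                                               (trans (combined-near near-w) w↦z)
      where
        near-w : Near _
        near-w = stays-in-component z≢x (guarded-vertex≢x w∈S)
                   (stays-or-steps-sym (subst (Stays-or-steps _) w↦z (D₁.move-stays-or-steps w∈S)))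
                   near-z

    far-guarded : ∀ {z} → z ∈ S₂ → z ≢ x → ¬ Near z → z ∈ T
    far-guarded z∈S₂ z≢x ¬near-z with D₂.move-onto z∈S₂
    ... | w , w∈S , w↦z = combined-lands-in-T w∈S w≢y₂ (trans (combined-far ¬near-w) w↦z)
      where
        ¬near-w : ¬ Near _
        ¬near-w = ¬near-z ∘ stays-in-component (guarded-vertex≢x w∈S) z≢x
                              (subst (Stays-or-steps _) w↦z (D₂.move-stays-or-steps w∈S))
        w≢y₂ : _ ≢ y₂
        w≢y₂ refl = z≢x (trans (sym w↦z) (proj₂ (D₂.unguarded-endpoint x∉S)))

    T-covers : IsVertexCover G T
    T-covers u v e with u ≟ x | v ≟ x
    ... | yes refl | _        = inj₁ x∈T
    ... | no _     | yes refl = inj₂ x∈T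
    ... | no u≢x   | no v≢x   with near? u
    ...   | yes near-u = Sum.map (λ u∈S₁ → near-guarded u∈S₁ u≢x near-u)
                                 (λ v∈S₁ → near-guarded v∈S₁ v≢x (near-u ◅◅ ((e , u≢x , v≢x) ◅ ε)))
                                 (cover₁ u v e)
    ...   | no ¬near-u = Sum.map (λ u∈S₂ → far-guarded u∈S₂ u≢x ¬near-u)
                                 (λ v∈S₂ → far-guarded v∈S₂ v≢x
                                    (λ near-v → ¬near-u (near-v ◅◅ ((adj-sym e , v≢x , u≢x) ◅ ε))))
                                 (cover₂ u v e)

  cut-vertices-guarded : ∀ {C k S x} → IsEVCClass G C k → (∀ T → IsVertexCover G T → k ≤ ∣ T ∣) →
                         C S → IsCutVertex G x → x ∈ S
  cut-vertices-guarded {k = k} {S} {x} (shape , defend) k-lower S∈C cut with x ∈? S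
  ... | yes x∈S = x∈S
  ... | no  x∉S with cut-vertex-separates-neighbours cut
  ...   | y₁ , y₂ , e₁ , e₂ , separated with defend S S∈C x y₁ e₁ | defend S S∈C x y₂ e₂
  ...     | S₁ , S₁∈C , d₁ | S₂ , S₂∈C , d₂ =
    -- Adj is not decidable, so neither is the component of y₁; the goal is ⊥, so ¬¬ suffices.
    Empty.⊥-elim (¬¬-decidable (Walk-avoiding x y₁) λ near? →
      let open Combined-defence x∉S (proj₁ (shape S₁ S₁∈C)) (proj₁ (shape S₂ S₂∈C))
                                d₁ d₂ separated near?
          open ≤-Reasoning
      in n≮n k (begin-strict
           k      ≤⟨ k-lower T T-covers ⟩
           ∣ T ∣  <⟨ T-smaller ⟩
           ∣ S ∣  ≡⟨ proj₂ (shape S S∈C) ⟩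
           k      ∎))

  minimum-in-class : ∀ {C k S} → IsEVCClass G C k → (∀ T → IsVertexCover G T → k ≤ ∣ T ∣) →
                     C S → IsMinVertexCover G S
  minimum-in-class {S = S} (shape , _) k-lower S∈C =
    proj₁ (shape S S∈C) ,
    λ T T-cover → subst (_≤ ∣ T ∣) (sym (proj₂ (shape S S∈C))) (k-lower T T-cover)

theorem1 : (G : Graph) → Connected G → 2 ≤ Graph.n G →
    (∃[ k ] (IsEVC G k × IsMVC G k)) →
    ∀ (v : Fin (Graph.n G)) → ¬ IsCutVertex G v →
    ∃[ S ] (IsMinVertexCover G S × v ∈ S × (∀ x → IsCutVertex G x → x ∈ S))
theorem1 G connected 2≤n (k , ((C , class , S₀ , S₀∈C) , _) , (_ , (_ , mvc-minimal) , mvc≡k)) v _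
  with occupied-in-class G class S₀∈C (proj₂ (neighbour G connected 2≤n v))
... | S , S∈C , v∈S =
  S , minimum-in-class G class k-lower S∈C , v∈S , λ x → cut-vertices-guarded G class k-lower S∈C
  where
    k-lower : ∀ T → IsVertexCover G T → k ≤ ∣ T ∣
    k-lower T T-cover = subst (_≤ ∣ T ∣) mvc≡k (mvc-minimal T T-cover)
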